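{- Let $\Phi$ be a root system of type $B_n$, let $(t_1,\dots,t_n)$ be a reduced reflection factorization of a quasi-Coxeter element of $W_\Phi$ with Carter diagram $\Gamma$ (vertices $t_1,\dots,t_n$), and let $i\in[n-1]$ be such that $t_i$ is the distinguished vertex of $\Gamma$. Let $\sigma_i(\Gamma)$ be the Carter diagram of $\sigma_i(t_1,\dots,t_n)$. Then $W(\Gamma)\cong W(\sigma_i(\Gamma))$.
   Context: For a reduced reflection factorization $(t_1,\dots,t_m)$ in a Weyl group, its Carter diagram has vertices $1,\dots,m$ (corresponding to $t_1,\dots,t_m$), vertices $i\ne j$ joined by $w_{ij}=m_{ij}-2$ edges where $m_{ij}$ is the order of $t_it_j$. In type $B_n$, the distinguished vertex is the vertex $t_i$ which is the (unique) reflection in the factorization along a short root; all edges at it have weight 2. $W(\Gamma)$ is the group generated by $t_1,\dots,t_m$ (as abstract symbols) subject to: $t_i^2=1$; $(t_it_j)^{w_{ij}+2}=1$ for $i\ne j$; and for every chordless cycle $i_0-i_1-\cdots-i_{d-1}-i_0$ of $\Gamma$ with all weights $1$ or $w_{i_{d-1}i_0}=2$, $(t_{i_0}t_{i_1}\cdots t_{i_{d-2}}t_{i_{d-1}}t_{i_{d-2}}\cdots t_{i_1})^2=1$. The Hurwitz move is $\sigma_i(t_1,\dots,t_m)=(t_1,\dots,t_{i-1},t_it_{i+1}t_i,t_i,t_{i+2},\dots,t_m)$. A quasi-Coxeter element of $W_\Phi$ (rank $n$) is an element with a reduced reflection factorization $(t_1,\dots,t_n)$ generating $W_\Phi$. 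-}

module Defs where

open import Level using (0ℓ)
open import Data.Nat as ℕ using (ℕ; zero; suc; _+_; _∸_; _≤_; _<_)
open import Data.Fin as Fin using (Fin; toℕ; fromℕ; inject₁; _≟_)
open import Data.Fin.Permutation as Perm using (Permutation; _⟨$⟩ʳ_; _∘ₚ_; transpose)
open import Data.Bool using (Bool; true; false; _xor_; not; _∨_)
open import Data.Product using (Σ; ∃; ∃-syntax; _×_; _,_)
open import Data.Sum using (_⊎_)
open import Data.List as List using (List; []; _∷_; _++_; reverse; map; concat)
open import Data.Vec as Vec using (Vec; []; _∷_; lookup; toList)
open import Data.Vec.Relation.Unary.All using (All)
open import Relation.Binary.PropositionalEquality using (_≡_; _≢_)
open import Relation.Nullary using (¬_)
open import Relation.Nullary.Decidable using (⌊_⌋)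
open import Function.Definitions using (Injective)
open import Algebra.Bundles.Raw using (RawGroup)

-- The Weyl group W(B_n) of the standard root system of type B_n
--   Φ = { ±e_k } ∪ { ±e_a ± e_b : a ≠ b }  ⊂ ℤ^n,
-- realised as the group of signed permutations: an element w sends the
-- basis vector e_j to (-1)^(sgn j) e_(perm j).

record W (n : ℕ) : Set where
  constructor sp
  field
    perm : Permutation n n
    sgn  : Fin n → Bool
open W public

_≈W_ : ∀ {n} → W n → W n → Set
v ≈W w = (∀ j → perm v ⟨$⟩ʳ j ≡ perm w ⟨$⟩ʳ j) × (∀ j → sgn v j ≡ sgn w j)

-- composition: (v · w) = v ∘ w (apply w first)
_·_ : ∀ {n} → W n → W n → W n
v · w = sp (perm w ∘ₚ perm v) (λ j → sgn w j xor sgn v (perm w ⟨$⟩ʳ j))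

idW : ∀ {n} → W n
idW = sp Perm.id (λ _ → false)

_^W_ : ∀ {n} → W n → ℕ → W n
w ^W zero  = idW
w ^W suc k = w · (w ^W k)

prodL : ∀ {n} → List (W n) → W n
prodL = List.foldr _·_ idW

prod : ∀ {n m} → Vec (W n) m → W n
prod ts = prodL (toList ts)

reflShort : ∀ {n} → Fin n → W n
reflShort k = sp Perm.id (λ j → ⌊ j ≟ k ⌋)

reflMinus : ∀ {n} → Fin n → Fin n → W n
reflMinus a b = sp (transpose a b) (λ _ → false)

-- s_{e_a + e_b} : e_a ↦ -e_b, e_b ↦ -e_a
reflPlus : ∀ {n} → Fin n → Fin n → W n
reflPlus a b = sp (transpose a b) (λ j → ⌊ j ≟ a ⌋ ∨ ⌊ j ≟ b ⌋)

IsShortReflection : ∀ {n} → W n → Set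
IsShortReflection {n} t = ∃[ k ] t ≈W reflShort k

IsReflection : ∀ {n} → W n → Set
IsReflection {n} t =
  IsShortReflection t ⊎
  (Σ (Fin n) λ a → Σ (Fin n) λ b → Fin._<_ a b × (t ≈W reflMinus a b ⊎ t ≈W reflPlus a b))

Reduced : ∀ {n m} → Vec (W n) m → Set
Reduced {n} {m} ts =
  ∀ k (ss : Vec (W n) k) → All IsReflection ss → prod ss ≈W prod ts → m ≤ k

Generates : ∀ {n m} → Vec (W n) m → Set
Generates {n} {m} ts =
  ∀ (w : W n) → ∃[ is ] prodL (map (lookup ts) is) ≈W w

IsQuasiCoxeter : ∀ {n} → W n → Set
IsQuasiCoxeter {n} w =
  ∃[ us ] (All IsReflection us × Reduced {n} {n} us × Generates us × prod us ≈W w)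

IsOrder : ∀ {n} → W n → ℕ → Set
IsOrder w k = 1 ≤ k × (w ^W k) ≈W idW × (∀ j → 1 ≤ j → j < k → ¬ ((w ^W j) ≈W idW))

-- Hurwitz move σ_i (0-based index i): (…, tᵢ, tᵢ₊₁, …) ↦ (…, tᵢtᵢ₊₁tᵢ, tᵢ, …)
hurwitz : ∀ {n m} → ℕ → Vec (W n) m → Vec (W n) m
hurwitz zero    (a ∷ b ∷ rest) = (a · (b · a)) ∷ a ∷ rest
hurwitz (suc i) (a ∷ rest)     = a ∷ hurwitz i rest
hurwitz _       ts             = ts

-- Carter diagrams: a diagram on vertex set Fin m is its weight function
-- wt i j = w_ij (the diagonal is irrelevant).

IsCarterDiagram : ∀ {n m} → Vec (W n) m → (Fin m → Fin m → ℕ) → Set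
IsCarterDiagram {n} {m} ts wt =
  ∀ (i j : Fin m) → i ≢ j → IsOrder (lookup ts i · lookup ts j) (wt i j + 2)

-- letters: a generator together with a flag "inverted"
Letter : ℕ → Set
Letter m = Fin m × Bool

Word : ℕ → Set
Word m = List (Letter m)

flipL : ∀ {m} → Letter m → Letter m
flipL (i , b) = (i , not b)

invW : ∀ {m} → Word m → Word m
invW u = reverse (map flipL u)

pos : ∀ {m} → List (Fin m) → Word m
pos = map (λ i → (i , false))

powWord : ∀ {m} → Word m → ℕ → Word m
powWord u zero    = []
powWord u (suc k) = u ++ powWord u k

CycAdj : ∀ {d} → Fin d → Fin d → Set
CycAdj {d} a b =
  toℕ b ≡ suc (toℕ a) ⊎ toℕ a ≡ suc (toℕ b) ⊎
  (toℕ a ≡ 0 × suc (toℕ b) ≡ d) ⊎ (suc (toℕ a) ≡ d × toℕ b ≡ 0)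

ChordlessCycle : ∀ {m} → (Fin m → Fin m → ℕ) → (k : ℕ) → (Fin (suc (suc (suc k))) → Fin m) → Set
ChordlessCycle wt k c =
  Injective _≡_ _≡_ c ×
  (∀ a b → CycAdj a b → 1 ≤ wt (c a) (c b)) ×
  (∀ a b → a ≢ b → ¬ CycAdj a b → wt (c a) (c b) ≡ 0)

lastPos : (k : ℕ) → Fin (suc (suc (suc k)))
lastPos k = fromℕ (suc (suc k))

CycleWeightCond : ∀ {m} → (Fin m → Fin m → ℕ) → (k : ℕ) → (Fin (suc (suc (suc k))) → Fin m) → Set
CycleWeightCond wt k c =
  (∀ a b → CycAdj a b → wt (c a) (c b) ≡ 1) ⊎ wt (c (lastPos k)) (c Fin.zero) ≡ 2

cycleWord : ∀ {m} (k : ℕ) → (Fin (suc (suc (suc k))) → Fin m) → Word m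
cycleWord k c =
  pos (c Fin.zero ∷ mid ++ c (lastPos k) ∷ reverse mid)
  where
  mid = List.tabulate {n = suc k} (λ j → c (Fin.suc (inject₁ j)))

data Relator {m : ℕ} (wt : Fin m → Fin m → ℕ) : Word m → Set where
  involution : ∀ i → Relator wt (pos (i ∷ i ∷ []))
  braid      : ∀ i j → i ≢ j → Relator wt (powWord (pos (i ∷ j ∷ [])) (wt i j + 2))
  cycle      : ∀ k c → ChordlessCycle wt k c → CycleWeightCond wt k c →
               Relator wt (powWord (cycleWord k c) 2)

data _∼⟨_⟩_ {m : ℕ} : Word m → (Fin m → Fin m → ℕ) → Word m → Set where
  ∼-refl  : ∀ {wt u} → u ∼⟨ wt ⟩ u
  ∼-sym   : ∀ {wt u v} → u ∼⟨ wt ⟩ v → v ∼⟨ wt ⟩ u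
  ∼-trans : ∀ {wt u v x} → u ∼⟨ wt ⟩ v → v ∼⟨ wt ⟩ x → u ∼⟨ wt ⟩ x
  ∼-cong  : ∀ {wt u v} a b → u ∼⟨ wt ⟩ v → (a ++ u ++ b) ∼⟨ wt ⟩ (a ++ v ++ b)
  ∼-free  : ∀ {wt} x → (x ∷ flipL x ∷ []) ∼⟨ wt ⟩ []
  ∼-rel   : ∀ {wt r} → Relator wt r → r ∼⟨ wt ⟩ []

WΓ : ∀ {m} → (Fin m → Fin m → ℕ) → RawGroup 0ℓ 0ℓ
WΓ {m} wt = record
  { Carrier = Word m
  ; _≈_     = λ u v → u ∼⟨ wt ⟩ v
  ; _∙_     = _++_
  ; ε       = []
  ; _⁻¹     = invW
  }

_≅ᴳ_ : RawGroup 0ℓ 0ℓ → RawGroup 0ℓ 0ℓ → Set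
G ≅ᴳ H = ∃[ f ] IsGroupIsomorphism f
  where open import Algebra.Morphism.Structures using (module GroupMorphisms)
        open GroupMorphisms G H

module Submission where

-- The move σᵢ turns (…, s, r, …) into (…, s r s, s, …), where s = tᵢ and r = tᵢ₊₁. The weight of
-- an edge is determined by the order of the product of its two reflections, so it suffices that
-- every product tₐ t_b is conjugate to the corresponding product after the move with the labels
-- i and i+1 exchanged; exchanging them is then an isomorphism Γ ≅ σᵢ(Γ) of weighted diagrams,
-- and a weight-preserving relabelling maps the defining relators of W(Γ) onto those of W(σᵢ(Γ)).
-- Up to the order of the factors, the only products that change are r x ↦ (s r s) x. As s is the reflection
-- in a short root e_k, either s commutes with r, or s commutes with x, or r and x are reflections
-- in long roots e_k ± e_b and e_k ± e_c; then b ≠ c, since otherwise r x or (s r s) x would be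
-- trivial, and the reflection in e_c commutes with r and conjugates x as s does.

open import Defs
open import Level using (0ℓ; _⊔_)
open import Algebra.Bundles using (Group)
open import Data.Bool using (Bool; true; false; not; _∧_; _∨_; _xor_)
open import Data.Bool.Properties using (xor-assoc; xor-comm; xor-same; xor-identityʳ; ∨-comm; ¬-not)
open import Data.Fin using (Fin; toℕ; inject₁; fromℕ<; _≟_)
import Data.Fin as Fin
open import Data.Fin.Permutation as Perm using (Permutation; _⟨$⟩ʳ_; _⟨$⟩ˡ_)
import Data.Fin.Permutation.Components as PC
open import Data.Fin.Properties using (<⇒≢; toℕ-injective; toℕ-fromℕ<; toℕ-inject₁)
open import Data.List as List using ([]; _∷_; _++_; reverse; map)
open import Data.List.Properties using (map-++; map-∘; map-cong; map-id; map-tabulate; reverse-map)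
open import Data.Nat using (ℕ; zero; suc; _+_; _≤_; _<_; s≤s; z≤n; s<s⁻¹)
open import Data.Nat.Properties using (<-cmp; +-cancelʳ-≡; m≤n+m; 1+n≢n)
open import Data.Product using (_,_; map₁)
open import Data.Sum using (inj₁; inj₂)
open import Data.Vec using (Vec; _∷_; lookup)
open import Data.Vec.Relation.Unary.All using (All)
open import Data.Vec.Relation.Unary.All.Properties using (lookup⁺)
open import Function using (_∘_; Injective)
open import Relation.Binary using (tri<; tri≈; tri>)
open import Relation.Binary.PropositionalEquality
  using (_≡_; _≢_; refl; sym; trans; cong; cong₂; subst; subst₂; module ≡-Reasoning)
open import Relation.Nullary using (¬_; yes; no; contradiction)
open import Relation.Nullary.Decidable using (⌊_⌋; dec-true; dec-false)

module Conjugation {c ℓ} (G : Group c ℓ) where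

  open Group G renaming (refl to ≈-refl; sym to ≈-sym; trans to ≈-trans)
  open import Algebra.Properties.Group G using (ε⁻¹≈ε; ⁻¹-anti-homo-∙; inverseʳ-unique)
  open import Algebra.Solver.Monoid monoid using (solve; _⊜_; _⊕_; id)
  open import Relation.Binary.Reasoning.Setoid setoid

  infixr 8 _^_
  _^_ : Carrier → ℕ → Carrier
  x ^ zero  = ε
  x ^ suc k = x ∙ x ^ k

  ^-cong : ∀ {x y} k → x ≈ y → x ^ k ≈ y ^ k
  ^-cong zero    x≈y = ≈-refl
  ^-cong (suc k) x≈y = ∙-cong x≈y (^-cong k x≈y)

  record HasOrder (x : Carrier) (k : ℕ) : Set ℓ where
    constructor hasOrder
    field
      1≤order  : 1 ≤ k
      ^-order  : x ^ k ≈ ε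
      minimal  : ∀ j → 1 ≤ j → j < k → ¬ x ^ j ≈ ε

  HasOrder-unique : ∀ {x p q} → HasOrder x p → HasOrder x q → p ≡ q
  HasOrder-unique {p = p} {q} (hasOrder 1≤p xᵖ≈ε p-min) (hasOrder 1≤q xᵠ≈ε q-min) with <-cmp p q
  ... | tri< p<q _ _ = contradiction xᵖ≈ε (q-min p 1≤p p<q)
  ... | tri≈ _ p≡q _ = p≡q
  ... | tri> _ _ q<p = contradiction xᵠ≈ε (p-min q 1≤q q<p)

  HasOrder⇒≉ε : ∀ {x k} → HasOrder x k → 1 < k → ¬ x ≈ ε
  HasOrder⇒≉ε (hasOrder _ _ k-min) 1<k x≈ε = k-min 1 (s≤s z≤n) 1<k (≈-trans (identityʳ _) x≈ε)

  conj : Carrier → Carrier → Carrier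
  conj g x = g ∙ x ∙ g ⁻¹

  conj-cong : ∀ {g h x y} → g ≈ h → x ≈ y → conj g x ≈ conj h y
  conj-cong g≈h x≈y = ∙-cong (∙-cong g≈h x≈y) (⁻¹-cong g≈h)

  conj-ε : ∀ g → conj g ε ≈ ε
  conj-ε g = ≈-trans (∙-congʳ (identityʳ g)) (inverseʳ g)

  conj-∙ : ∀ g x y → conj g (x ∙ y) ≈ conj g x ∙ conj g y
  conj-∙ g x y = begin
    g ∙ (x ∙ y) ∙ g ⁻¹
      ≈⟨ solve 4 (λ g x y g′ → (g ⊕ (x ⊕ y)) ⊕ g′ ⊜ (((g ⊕ x) ⊕ id) ⊕ y) ⊕ g′) ≈-refl g x y (g ⁻¹) ⟩
    g ∙ x ∙ ε ∙ y ∙ g ⁻¹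
      ≈⟨ ∙-congʳ (∙-congʳ (∙-congˡ (inverseˡ g))) ⟨
    g ∙ x ∙ (g ⁻¹ ∙ g) ∙ y ∙ g ⁻¹
      ≈⟨ solve 4 (λ g x y g′ → (((g ⊕ x) ⊕ (g′ ⊕ g)) ⊕ y) ⊕ g′ ⊜ ((g ⊕ x) ⊕ g′) ⊕ ((g ⊕ y) ⊕ g′))
               ≈-refl g x y (g ⁻¹) ⟩
    conj g x ∙ conj g y
      ∎

  conj-^ : ∀ g x k → conj g (x ^ k) ≈ conj g x ^ k
  conj-^ g x zero    = conj-ε g
  conj-^ g x (suc k) = ≈-trans (conj-∙ g x (x ^ k)) (∙-congˡ (conj-^ g x k))

  conj-identity : ∀ x → conj ε x ≈ x
  conj-identity x = ≈-trans (∙-cong (identityˡ x) ε⁻¹≈ε) (identityʳ x)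

  conj-∘ : ∀ g h x → conj g (conj h x) ≈ conj (g ∙ h) x
  conj-∘ g h x = begin
    g ∙ (h ∙ x ∙ h ⁻¹) ∙ g ⁻¹
      ≈⟨ solve 5 (λ g h x h′ g′ → (g ⊕ ((h ⊕ x) ⊕ h′)) ⊕ g′ ⊜ ((g ⊕ h) ⊕ x) ⊕ (h′ ⊕ g′))
               ≈-refl g h x (h ⁻¹) (g ⁻¹) ⟩
    g ∙ h ∙ x ∙ (h ⁻¹ ∙ g ⁻¹)
      ≈⟨ ∙-congˡ (⁻¹-anti-homo-∙ g h) ⟨
    conj (g ∙ h) x
      ∎

  conj-inverse : ∀ g x → conj (g ⁻¹) (conj g x) ≈ x
  conj-inverse g x = ≈-trans (conj-∘ (g ⁻¹) g x) (≈-trans (conj-cong (inverseˡ g) ≈-refl) (conj-identity x))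

  record Conjugate (x y : Carrier) : Set (c ⊔ ℓ) where
    constructor conjugate-by
    field
      conjugator : Carrier
      conj≈      : conj conjugator x ≈ y

  ≈⇒Conjugate : ∀ {x y} → x ≈ y → Conjugate x y
  ≈⇒Conjugate {x} x≈y = conjugate-by ε (≈-trans (conj-identity x) x≈y)

  Conjugate-sym : ∀ {x y} → Conjugate x y → Conjugate y x
  Conjugate-sym {x} (conjugate-by g gxg⁻¹≈y) =
    conjugate-by (g ⁻¹) (≈-trans (conj-cong ≈-refl (≈-sym gxg⁻¹≈y)) (conj-inverse g x))

  Conjugate-trans : ∀ {x y z} → Conjugate x y → Conjugate y z → Conjugate x z
  Conjugate-trans {x} (conjugate-by g gxg⁻¹≈y) (conjugate-by h hyh⁻¹≈z) =
    conjugate-by (h ∙ g) (≈-trans (≈-sym (conj-∘ h g x)) (≈-trans (conj-cong ≈-refl gxg⁻¹≈y) hyh⁻¹≈z))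

  ∙-comm-Conjugate : ∀ x y → Conjugate (x ∙ y) (y ∙ x)
  ∙-comm-Conjugate x y = conjugate-by y (begin
    y ∙ (x ∙ y) ∙ y ⁻¹    ≈⟨ solve 3 (λ x y y′ → (y ⊕ (x ⊕ y)) ⊕ y′ ⊜ (y ⊕ x) ⊕ (y ⊕ y′))
                                    ≈-refl x y (y ⁻¹) ⟩
    y ∙ x ∙ (y ∙ y ⁻¹)    ≈⟨ ∙-congˡ (inverseʳ y) ⟩
    y ∙ x ∙ ε             ≈⟨ identityʳ (y ∙ x) ⟩
    y ∙ x                 ∎)

  Conjugate-≈ε : ∀ {x y} → Conjugate x y → x ≈ ε → y ≈ ε
  Conjugate-≈ε {x} {y} (conjugate-by g gxg⁻¹≈y) x≈ε = begin
    y           ≈⟨ gxg⁻¹≈y ⟨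
    conj g x    ≈⟨ conj-cong ≈-refl x≈ε ⟩
    conj g ε    ≈⟨ conj-ε g ⟩
    ε           ∎

  Conjugate-^ : ∀ {x y} k → Conjugate x y → Conjugate (x ^ k) (y ^ k)
  Conjugate-^ {x} k (conjugate-by g gxg⁻¹≈y) =
    conjugate-by g (≈-trans (conj-^ g x k) (^-cong k gxg⁻¹≈y))

  Conjugate-swap : ∀ x y z w → Conjugate (x ∙ y) (z ∙ w) → Conjugate (y ∙ x) (w ∙ z)
  Conjugate-swap x y z w xy~zw =
    Conjugate-trans (∙-comm-Conjugate y x) (Conjugate-trans xy~zw (∙-comm-Conjugate z w))

  Conjugate-HasOrder : ∀ {x y k} → Conjugate x y → HasOrder x k → HasOrder y k
  Conjugate-HasOrder {k = k} x~y (hasOrder 1≤k xᵏ≈ε k-min) =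
    hasOrder 1≤k (Conjugate-≈ε (Conjugate-^ k x~y) xᵏ≈ε)
      λ j 1≤j j<k yʲ≈ε → k-min j 1≤j j<k (Conjugate-≈ε (Conjugate-^ j (Conjugate-sym x~y)) yʲ≈ε)

  Conjugate⇒order-≡ : ∀ {x y p q} → Conjugate x y → HasOrder x p → HasOrder y q → p ≡ q
  Conjugate⇒order-≡ x~y xᵖ yᵠ = HasOrder-unique (Conjugate-HasOrder x~y xᵖ) yᵠ

  involution-conj : ∀ {s} x → s ∙ s ≈ ε → conj s x ≈ s ∙ (x ∙ s)
  involution-conj {s} x s²≈ε =
    ≈-trans (∙-congˡ (≈-sym (inverseʳ-unique s s s²≈ε))) (assoc s x s)

  commute-cong : ∀ {g h x y} → g ≈ h → x ≈ y → h ∙ y ≈ y ∙ h → g ∙ x ≈ x ∙ g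
  commute-cong g≈h x≈y hy≈yh = ≈-trans (∙-cong g≈h x≈y) (≈-trans hy≈yh (≈-sym (∙-cong x≈y g≈h)))

  sandwich-cong : ∀ {g h x y} → g ≈ h → x ≈ y → g ∙ (x ∙ g) ≈ h ∙ (y ∙ h)
  sandwich-cong g≈h x≈y = ∙-cong g≈h (∙-cong x≈y g≈h)

  involution-commute : ∀ g r → g ∙ g ≈ ε → g ∙ r ≈ r ∙ g → g ∙ (r ∙ g) ≈ r
  involution-commute g r g²≈ε gr≈rg = begin
    g ∙ (r ∙ g)    ≈⟨ ∙-congˡ gr≈rg ⟨
    g ∙ (g ∙ r)    ≈⟨ assoc g g r ⟨
    g ∙ g ∙ r      ≈⟨ ∙-congʳ g²≈ε ⟩
    ε ∙ r          ≈⟨ identityˡ r ⟩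
    r              ∎

  -- g fixes r and moves x exactly as s does; conjugating r ∙ x first by g and then by s
  -- therefore replaces r by s r s.
  Conjugate-by-involutions : ∀ s g r x → s ∙ s ≈ ε → g ∙ g ≈ ε → g ∙ r ≈ r ∙ g →
                             g ∙ (x ∙ g) ≈ s ∙ (x ∙ s) → Conjugate (r ∙ x) (s ∙ (r ∙ s) ∙ x)
  Conjugate-by-involutions s g r x s²≈ε g²≈ε gr≈rg gxg≈sxs =
    Conjugate-trans (conjugate-by g by-g) (conjugate-by s by-s)
    where
    by-g : conj g (r ∙ x) ≈ r ∙ (s ∙ (x ∙ s))
    by-g = begin
      conj g (r ∙ x)                ≈⟨ conj-∙ g r x ⟩
      conj g r ∙ conj g x           ≈⟨ ∙-cong (involution-conj r g²≈ε) (involution-conj x g²≈ε) ⟩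
      g ∙ (r ∙ g) ∙ (g ∙ (x ∙ g))   ≈⟨ ∙-cong (involution-commute g r g²≈ε gr≈rg) gxg≈sxs ⟩
      r ∙ (s ∙ (x ∙ s))             ∎
    by-s : conj s (r ∙ (s ∙ (x ∙ s))) ≈ s ∙ (r ∙ s) ∙ x
    by-s = begin
      conj s (r ∙ (s ∙ (x ∙ s)))     ≈⟨ involution-conj _ s²≈ε ⟩
      s ∙ (r ∙ (s ∙ (x ∙ s)) ∙ s)
        ≈⟨ solve 3 (λ s r x → s ⊕ ((r ⊕ (s ⊕ (x ⊕ s))) ⊕ s) ⊜ ((s ⊕ (r ⊕ s)) ⊕ x) ⊕ (s ⊕ s)) ≈-refl s r x ⟩
      s ∙ (r ∙ s) ∙ x ∙ (s ∙ s)      ≈⟨ ∙-congˡ s²≈ε ⟩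
      s ∙ (r ∙ s) ∙ x ∙ ε            ≈⟨ identityʳ _ ⟩
      s ∙ (r ∙ s) ∙ x                ∎

-- Relabelling the vertices of a diagram

relabel : ∀ {m m′} → (Fin m → Fin m′) → Word m → Word m′
relabel π = map (map₁ π)

module _ {m m′} (π : Fin m → Fin m′) where

  relabel-powWord : ∀ u k → relabel π (powWord u k) ≡ powWord (relabel π u) k
  relabel-powWord u zero    = refl
  relabel-powWord u (suc k) =
    trans (map-++ (map₁ π) u (powWord u k)) (cong (relabel π u ++_) (relabel-powWord u k))

  relabel-pos : ∀ is → relabel π (pos is) ≡ pos (map π is)
  relabel-pos is = trans (sym (map-∘ is)) (map-∘ is)

  relabel-invW : ∀ u → relabel π (invW u) ≡ invW (relabel π u)
  relabel-invW u = trans (reverse-map (map₁ π) (map flipL u)) (cong reverse (trans (sym (map-∘ u)) (map-∘ u)))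

  relabel-cycleWord : ∀ k c → relabel π (cycleWord k c) ≡ cycleWord k (π ∘ c)
  relabel-cycleWord k c = begin
    relabel π (pos (first ∷ mid ++ last ∷ reverse mid))
      ≡⟨ relabel-pos (first ∷ mid ++ last ∷ reverse mid) ⟩
    pos (π first ∷ map π (mid ++ last ∷ reverse mid))
      ≡⟨ cong (λ is → pos (π first ∷ is)) (map-++ π mid (last ∷ reverse mid)) ⟩
    pos (π first ∷ map π mid ++ π last ∷ map π (reverse mid))
      ≡⟨ cong (λ is → pos (π first ∷ map π mid ++ π last ∷ is)) (reverse-map π mid) ⟩
    pos (π first ∷ map π mid ++ π last ∷ reverse (map π mid))
      ≡⟨ cong (λ is → pos (π first ∷ is ++ π last ∷ reverse is)) (map-tabulate (c ∘ Fin.suc ∘ inject₁) π) ⟩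
    cycleWord k (π ∘ c) ∎
    where
    open ≡-Reasoning
    first = c Fin.zero
    last = c (lastPos k)
    mid = List.tabulate {n = suc k} (c ∘ Fin.suc ∘ inject₁)

CycAdj⇒≢ : ∀ {k} (a b : Fin (suc (suc (suc k)))) → CycAdj a b → a ≢ b
CycAdj⇒≢ a .a (inj₁ 1+a≡a) refl = 1+n≢n (sym 1+a≡a)
CycAdj⇒≢ a .a (inj₂ (inj₁ a≡1+a)) refl = 1+n≢n (sym a≡1+a)
CycAdj⇒≢ a .a (inj₂ (inj₂ (inj₁ (a≡0 , 1+a≡d)))) refl with toℕ a
CycAdj⇒≢ a .a (inj₂ (inj₂ (inj₁ (refl , ())))) refl | .0
CycAdj⇒≢ a .a (inj₂ (inj₂ (inj₂ (1+a≡d , a≡0)))) refl with toℕ a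
CycAdj⇒≢ a .a (inj₂ (inj₂ (inj₂ (() , refl)))) refl | .0

module Relabelling {m : ℕ} {Γ Γ′ : Fin m → Fin m → ℕ} (π : Fin m → Fin m) (π-injective : Injective _≡_ _≡_ π)
                   (π-preserves : ∀ a b → a ≢ b → Γ′ (π a) (π b) ≡ Γ a b) where

  private
    π-preserves-≢ : ∀ {a b} → a ≢ b → π a ≢ π b
    π-preserves-≢ a≢b = a≢b ∘ π-injective

  relabel-ChordlessCycle : ∀ {k c} → ChordlessCycle Γ k c → ChordlessCycle Γ′ k (π ∘ c)
  relabel-ChordlessCycle {k} {c} (c-injective , adjacent , nonadjacent) =
      c-injective ∘ π-injective
    , (λ a b ab → subst (1 ≤_) (sym (preserves a b (CycAdj⇒≢ a b ab))) (adjacent a b ab))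
    , (λ a b a≢b ¬ab → trans (preserves a b a≢b) (nonadjacent a b a≢b ¬ab))
    where
    preserves : ∀ a b → a ≢ b → Γ′ (π (c a)) (π (c b)) ≡ Γ (c a) (c b)
    preserves a b a≢b = π-preserves (c a) (c b) (a≢b ∘ c-injective)

  relabel-CycleWeightCond : ∀ {k c} → ChordlessCycle Γ k c → CycleWeightCond Γ k c →
                            CycleWeightCond Γ′ k (π ∘ c)
  relabel-CycleWeightCond {k} {c} (c-injective , _) (inj₁ all-one) =
    inj₁ (λ a b ab → trans (π-preserves (c a) (c b) (CycAdj⇒≢ a b ab ∘ c-injective)) (all-one a b ab))
  relabel-CycleWeightCond {k} {c} (c-injective , _) (inj₂ closing-two) =
    inj₂ (trans (π-preserves (c (lastPos k)) (c Fin.zero) ((λ ()) ∘ c-injective)) closing-two)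

  relabel-Relator : ∀ {r} → Relator Γ r → Relator Γ′ (relabel π r)
  relabel-Relator (involution i) = involution (π i)
  relabel-Relator (braid i j i≢j) =
    subst (Relator Γ′) (sym (relabel-powWord π (pos (i ∷ j ∷ [])) (Γ i j + 2)))
      (subst (λ w → Relator Γ′ (powWord (pos (π i ∷ π j ∷ [])) (w + 2))) (π-preserves i j i≢j)
        (braid (π i) (π j) (π-preserves-≢ i≢j)))
  relabel-Relator (cycle k c chordless weights) =
    subst (Relator Γ′)
      (sym (trans (relabel-powWord π (cycleWord k c) 2) (cong (λ u → powWord u 2) (relabel-cycleWord π k c))))
      (cycle k (π ∘ c) (relabel-ChordlessCycle chordless) (relabel-CycleWeightCond chordless weights))

  relabel-∼ : ∀ {u v} → u ∼⟨ Γ ⟩ v → relabel π u ∼⟨ Γ′ ⟩ relabel π v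
  relabel-∼ ∼-refl = ∼-refl
  relabel-∼ (∼-sym u∼v) = ∼-sym (relabel-∼ u∼v)
  relabel-∼ (∼-trans u∼v v∼w) = ∼-trans (relabel-∼ u∼v) (relabel-∼ v∼w)
  relabel-∼ (∼-cong {u = u} {v = v} a b u∼v)
    rewrite map-++ (map₁ π) a (u ++ b) | map-++ (map₁ π) u b
          | map-++ (map₁ π) a (v ++ b) | map-++ (map₁ π) v b
          = ∼-cong (relabel π a) (relabel π b) (relabel-∼ u∼v)
  relabel-∼ (∼-free x) = ∼-free (map₁ π x)
  relabel-∼ (∼-rel r) = ∼-rel (relabel-Relator r)

relabel-inverse : ∀ {m m′} {σ : Fin m′ → Fin m} {τ : Fin m → Fin m′} → (∀ i → σ (τ i) ≡ i) →
                  ∀ u → relabel σ (relabel τ u) ≡ u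
relabel-inverse {σ = σ} {τ} στ≗id u =
  trans (sym (map-∘ u)) (trans (map-cong (λ (i , b) → cong (_, b) (στ≗id i)) u) (map-id u))

relabel-≅ : ∀ {m} {Γ Γ′ : Fin m → Fin m → ℕ} (π : Permutation m m) →
            (∀ a b → a ≢ b → Γ′ (π ⟨$⟩ʳ a) (π ⟨$⟩ʳ b) ≡ Γ a b) → WΓ Γ ≅ᴳ WΓ Γ′
relabel-≅ {m} {Γ} {Γ′} π π-preserves = relabel (π ⟨$⟩ʳ_) , record
  { isGroupMonomorphism = record
    { isGroupHomomorphism = record
      { isMonoidHomomorphism = record
        { isMagmaHomomorphism = record
          { isRelHomomorphism = record { cong = forward }
          ; homo = λ u v → ≡⇒∼ (map-++ (map₁ (π ⟨$⟩ʳ_)) u v) }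
        ; ε-homo = ∼-refl }
      ; ⁻¹-homo = λ u → ≡⇒∼ (relabel-invW (π ⟨$⟩ʳ_) u) }
    ; injective = λ {u} {v} πu∼πv →
        subst₂ (λ u′ v′ → u′ ∼⟨ Γ ⟩ v′) (relabel-inverse (λ _ → Perm.inverseˡ π) u)
          (relabel-inverse (λ _ → Perm.inverseˡ π) v) (backward πu∼πv) }
  ; surjective = λ v → relabel (π ⟨$⟩ˡ_) v , λ {u} u∼π⁻¹v →
      subst (λ v′ → relabel (π ⟨$⟩ʳ_) u ∼⟨ Γ′ ⟩ v′) (relabel-inverse (λ _ → Perm.inverseʳ π) v)
        (forward u∼π⁻¹v) }
  where
  ≡⇒∼ : ∀ {Δ : Fin m → Fin m → ℕ} {u v} → u ≡ v → u ∼⟨ Δ ⟩ v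
  ≡⇒∼ refl = ∼-refl

  π-injective : Injective _≡_ _≡_ (π ⟨$⟩ʳ_)
  π-injective {a} {b} πa≡πb = trans (sym (Perm.inverseˡ π)) (trans (cong (π ⟨$⟩ˡ_) πa≡πb) (Perm.inverseˡ π))

  π⁻¹-injective : Injective _≡_ _≡_ (π ⟨$⟩ˡ_)
  π⁻¹-injective {a} {b} π⁻¹a≡π⁻¹b =
    trans (sym (Perm.inverseʳ π)) (trans (cong (π ⟨$⟩ʳ_) π⁻¹a≡π⁻¹b) (Perm.inverseʳ π))

  π⁻¹-preserves : ∀ a b → a ≢ b → Γ (π ⟨$⟩ˡ a) (π ⟨$⟩ˡ b) ≡ Γ′ a b
  π⁻¹-preserves a b a≢b =
    trans (sym (π-preserves (π ⟨$⟩ˡ a) (π ⟨$⟩ˡ b) (a≢b ∘ π⁻¹-injective)))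
          (cong₂ Γ′ (Perm.inverseʳ π) (Perm.inverseʳ π))

  forward : ∀ {u v} → u ∼⟨ Γ ⟩ v → relabel (π ⟨$⟩ʳ_) u ∼⟨ Γ′ ⟩ relabel (π ⟨$⟩ʳ_) v
  forward = Relabelling.relabel-∼ (π ⟨$⟩ʳ_) π-injective π-preserves

  backward : ∀ {u v} → u ∼⟨ Γ′ ⟩ v → relabel (π ⟨$⟩ˡ_) u ∼⟨ Γ ⟩ relabel (π ⟨$⟩ˡ_) v
  backward = Relabelling.relabel-∼ (π ⟨$⟩ˡ_) π⁻¹-injective π⁻¹-preserves

-- W(B_n) as a group of signed permutations

module _ {n : ℕ} where

  transpose-matchˡ : ∀ (a b : Fin n) → PC.transpose a b a ≡ b
  transpose-matchˡ a b rewrite dec-true (a ≟ a) refl = refl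

  transpose-matchʳ : ∀ (a b : Fin n) → PC.transpose a b b ≡ a
  transpose-matchʳ a b with b ≟ a
  ... | yes refl = refl
  ... | no _ rewrite dec-true (b ≟ b) refl = refl

  transpose-noMatch : ∀ {a b j : Fin n} → j ≢ a → j ≢ b → PC.transpose a b j ≡ j
  transpose-noMatch {a} {b} {j} j≢a j≢b rewrite dec-false (j ≟ a) j≢a | dec-false (j ≟ b) j≢b = refl

  transpose-comm : ∀ (a b j : Fin n) → PC.transpose a b j ≡ PC.transpose b a j
  transpose-comm a b j with a ≟ j | b ≟ j
  ... | yes refl | _ = trans (transpose-matchˡ a b) (sym (transpose-matchʳ b a))
  ... | no _ | yes refl = trans (transpose-matchʳ a b) (sym (transpose-matchˡ b a))
  ... | no a≢j | no b≢j =
    trans (transpose-noMatch (a≢j ∘ sym) (b≢j ∘ sym)) (sym (transpose-noMatch (b≢j ∘ sym) (a≢j ∘ sym)))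

  transpose-involutive : ∀ (a b j : Fin n) → PC.transpose a b (PC.transpose a b j) ≡ j
  transpose-involutive a b j = trans (cong (PC.transpose a b) (transpose-comm a b j)) (PC.transpose-inverse a b)

  ≟-involution : ∀ {f : Fin n → Fin n} → (∀ j → f (f j) ≡ j) → ∀ j k → ⌊ f j ≟ k ⌋ ≡ ⌊ j ≟ f k ⌋
  ≟-involution {f} f-inv j k with f j ≟ k | j ≟ f k
  ... | yes _ | yes _ = refl
  ... | no _ | no _ = refl
  ... | yes fj≡k | no j≢fk = contradiction (trans (sym (f-inv j)) (cong f fj≡k)) j≢fk
  ... | no fj≢k | yes j≡fk = contradiction (trans (cong f j≡fk) (f-inv k)) fj≢k

module _ {n : ℕ} where

  ≈W-refl : ∀ {w : W n} → w ≈W w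
  ≈W-refl = (λ _ → refl) , (λ _ → refl)

  ≈W-sym : ∀ {v w : W n} → v ≈W w → w ≈W v
  ≈W-sym (p , q) = (λ j → sym (p j)) , (λ j → sym (q j))

  ≈W-trans : ∀ {u v w : W n} → u ≈W v → v ≈W w → u ≈W w
  ≈W-trans (p , q) (p′ , q′) = (λ j → trans (p j) (p′ j)) , (λ j → trans (q j) (q′ j))

  ·-cong : ∀ {v v′ w w′ : W n} → v ≈W v′ → w ≈W w′ → (v · w) ≈W (v′ · w′)
  ·-cong {v} {v′} {w} {w′} (p , q) (p′ , q′) =
    (λ j → trans (cong (perm v ⟨$⟩ʳ_) (p′ j)) (p (perm w′ ⟨$⟩ʳ j))) ,
    (λ j → cong₂ _xor_ (q′ j) (trans (cong (sgn v) (p′ j)) (q (perm w′ ⟨$⟩ʳ j))))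

  inverseW : W n → W n
  inverseW w = sp (Perm.flip (perm w)) (λ j → sgn w (perm w ⟨$⟩ˡ j))

  inverseW-cong : ∀ {v w : W n} → v ≈W w → inverseW v ≈W inverseW w
  inverseW-cong {v} {w} (p , q) = perm⁻¹-cong , (λ j → trans (q _) (cong (sgn w) (perm⁻¹-cong j)))
    where
    perm⁻¹-cong : ∀ j → perm v ⟨$⟩ˡ j ≡ perm w ⟨$⟩ˡ j
    perm⁻¹-cong j =
      trans (sym (Perm.inverseˡ (perm w))) (cong (perm w ⟨$⟩ˡ_) (trans (sym (p _)) (Perm.inverseʳ (perm v))))

-- _≈W_ unfolds to pointwise equations from which Agda cannot recover the two elements;
-- the record wrapper makes them inferable in equational reasoning.
infix 4 _≋_
record _≋_ {n} (v w : W n) : Set where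
  constructor ≈W⇒≋
  field ≋⇒≈W : v ≈W w
open _≋_ public

W-group : ℕ → Group 0ℓ 0ℓ
W-group n = record
  { Carrier = W n
  ; _≈_ = _≋_
  ; _∙_ = _·_
  ; ε = idW
  ; _⁻¹ = inverseW
  ; isGroup = record
    { isMonoid = record
      { isSemigroup = record
        { isMagma = record
          { isEquivalence = record
            { refl = λ {w} → ≈W⇒≋ (≈W-refl {n} {w})
            ; sym = λ {v} {w} v≋w → ≈W⇒≋ (≈W-sym {n} {v} {w} (≋⇒≈W v≋w))
            ; trans = λ {u} {v} {w} u≋v v≋w → ≈W⇒≋ (≈W-trans {n} {u} {v} {w} (≋⇒≈W u≋v) (≋⇒≈W v≋w)) }
          ; ∙-cong = λ {v} {v′} {w} {w′} v≋v′ w≋w′ →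
              ≈W⇒≋ (·-cong {n} {v} {v′} {w} {w′} (≋⇒≈W v≋v′) (≋⇒≈W w≋w′)) }
        ; assoc = λ u v w → ≈W⇒≋ ((λ _ → refl) , (λ j → sym (xor-assoc (sgn w j) _ _))) }
      ; identity = (λ w → ≈W⇒≋ ((λ _ → refl) , (λ j → xor-identityʳ _))) , (λ w → ≈W⇒≋ (≈W-refl {n} {w})) }
    ; inverse = (λ w → ≈W⇒≋ ((λ _ → Perm.inverseˡ (perm w)) ,
                       (λ j → trans (cong (sgn w j xor_) (cong (sgn w) (Perm.inverseˡ (perm w)))) (xor-same (sgn w j)))))
              , (λ w → ≈W⇒≋ ((λ _ → Perm.inverseʳ (perm w)) , (λ j → xor-same (sgn w (perm w ⟨$⟩ˡ j)))))
    ; ⁻¹-cong = λ {v} {w} v≋w → ≈W⇒≋ (inverseW-cong {n} {v} {w} (≋⇒≈W v≋w)) } }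

module _ {n : ℕ} where

  open Conjugation (W-group n) using (_^_; HasOrder; hasOrder; HasOrder⇒≉ε)

  ^W≡^ : ∀ (w : W n) k → w ^W k ≡ w ^ k
  ^W≡^ w zero    = refl
  ^W≡^ w (suc k) = cong (w ·_) (^W≡^ w k)

  IsOrder⇒HasOrder : ∀ {w : W n} {k} → IsOrder w k → HasOrder w k
  IsOrder⇒HasOrder {w} {k} (1≤k , wᵏ≈ε , k-min) =
    hasOrder 1≤k (≈W⇒≋ (subst (_≈W idW) (^W≡^ w k) wᵏ≈ε))
      λ j 1≤j j<k wʲ≋ε → k-min j 1≤j j<k (subst (_≈W idW) (sym (^W≡^ w j)) (≋⇒≈W wʲ≋ε))

  IsOrder-+2⇒≉ε : ∀ {w : W n} {k} → IsOrder w (k + 2) → ¬ w ≋ idW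
  IsOrder-+2⇒≉ε {k = k} w-order = HasOrder⇒≉ε (IsOrder⇒HasOrder w-order) (m≤n+m 2 k)

-- Reflections in short and long roots

module _ {n : ℕ} where

  -- reflLong false a b is reflMinus a b and reflLong true a b is reflPlus a b, definitionally.
  reflLong : Bool → Fin n → Fin n → W n
  reflLong p a b = sp (Perm.transpose a b) (λ j → p ∧ (⌊ j ≟ a ⌋ ∨ ⌊ j ≟ b ⌋))

  private
    ⌊transpose≟⌋ : ∀ (a b j k : Fin n) → ⌊ PC.transpose a b j ≟ k ⌋ ≡ ⌊ j ≟ PC.transpose a b k ⌋
    ⌊transpose≟⌋ a b = ≟-involution (transpose-involutive a b)

    ⌊transpose≟ˡ⌋ : ∀ (a b j : Fin n) → ⌊ PC.transpose a b j ≟ a ⌋ ≡ ⌊ j ≟ b ⌋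
    ⌊transpose≟ˡ⌋ a b j = trans (⌊transpose≟⌋ a b j a) (cong (λ k → ⌊ j ≟ k ⌋) (transpose-matchˡ a b))

    ⌊transpose≟ʳ⌋ : ∀ (a b j : Fin n) → ⌊ PC.transpose a b j ≟ b ⌋ ≡ ⌊ j ≟ a ⌋
    ⌊transpose≟ʳ⌋ a b j = trans (⌊transpose≟⌋ a b j b) (cong (λ k → ⌊ j ≟ k ⌋) (transpose-matchʳ a b))

    ⌊transpose≟noMatch⌋ : ∀ {a b k : Fin n} j → k ≢ a → k ≢ b → ⌊ PC.transpose a b j ≟ k ⌋ ≡ ⌊ j ≟ k ⌋
    ⌊transpose≟noMatch⌋ {a} {b} {k} j k≢a k≢b =
      trans (⌊transpose≟⌋ a b j k) (cong (λ k′ → ⌊ j ≟ k′ ⌋) (transpose-noMatch k≢a k≢b))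

    ⌊≟⌋-disjoint : ∀ {a b : Fin n} j → a ≢ b → ⌊ j ≟ a ⌋ ∧ ⌊ j ≟ b ⌋ ≡ false
    ⌊≟⌋-disjoint {a} {b} j a≢b with j ≟ a | j ≟ b
    ... | yes refl | yes refl = contradiction refl a≢b
    ... | yes _ | no _ = refl
    ... | no _ | _ = refl

    sign-flip : ∀ p x y → x ∧ y ≡ false → (x xor p ∧ (x ∨ y)) xor y ≡ not p ∧ (x ∨ y)
    sign-flip false false false _ = refl
    sign-flip false false true  _ = refl
    sign-flip false true  false _ = refl
    sign-flip true  false false _ = refl
    sign-flip true  false true  _ = refl
    sign-flip true  true  false _ = refl

  reflShort-involutive : ∀ (k : Fin n) → reflShort k · reflShort k ≋ idW
  reflShort-involutive k = ≈W⇒≋ ((λ _ → refl) , (λ j → xor-same ⌊ j ≟ k ⌋))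

  reflShort-comm : ∀ (k c : Fin n) → reflShort k · reflShort c ≋ reflShort c · reflShort k
  reflShort-comm k c = ≈W⇒≋ ((λ _ → refl) , (λ j → xor-comm ⌊ j ≟ c ⌋ ⌊ j ≟ k ⌋))

  reflLong-comm : ∀ p (a b : Fin n) → reflLong p a b ≋ reflLong p b a
  reflLong-comm p a b = ≈W⇒≋ (transpose-comm a b , (λ j → cong (p ∧_) (∨-comm ⌊ j ≟ a ⌋ ⌊ j ≟ b ⌋)))

  reflLong-involutive : ∀ p (a b : Fin n) → reflLong p a b · reflLong p a b ≋ idW
  reflLong-involutive p a b = ≈W⇒≋ (transpose-involutive a b , λ j → begin
    p ∧ (⌊ j ≟ a ⌋ ∨ ⌊ j ≟ b ⌋) xor p ∧ (⌊ τ j ≟ a ⌋ ∨ ⌊ τ j ≟ b ⌋)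
      ≡⟨ cong₂ (λ x y → p ∧ (⌊ j ≟ a ⌋ ∨ ⌊ j ≟ b ⌋) xor p ∧ (x ∨ y))
               (⌊transpose≟ˡ⌋ a b j) (⌊transpose≟ʳ⌋ a b j) ⟩
    p ∧ (⌊ j ≟ a ⌋ ∨ ⌊ j ≟ b ⌋) xor p ∧ (⌊ j ≟ b ⌋ ∨ ⌊ j ≟ a ⌋)
      ≡⟨ cong (λ x → p ∧ (⌊ j ≟ a ⌋ ∨ ⌊ j ≟ b ⌋) xor p ∧ x) (∨-comm ⌊ j ≟ b ⌋ ⌊ j ≟ a ⌋) ⟩
    p ∧ (⌊ j ≟ a ⌋ ∨ ⌊ j ≟ b ⌋) xor p ∧ (⌊ j ≟ a ⌋ ∨ ⌊ j ≟ b ⌋)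
      ≡⟨ xor-same (p ∧ (⌊ j ≟ a ⌋ ∨ ⌊ j ≟ b ⌋)) ⟩
    false ∎)
    where
    open ≡-Reasoning
    τ = PC.transpose a b

  reflShort-reflLong-comm : ∀ {k a b : Fin n} p → k ≢ a → k ≢ b →
                            reflShort k · reflLong p a b ≋ reflLong p a b · reflShort k
  reflShort-reflLong-comm {k} {a} {b} p k≢a k≢b = ≈W⇒≋ ((λ _ → refl) , λ j →
    trans (cong (p ∧ (⌊ j ≟ a ⌋ ∨ ⌊ j ≟ b ⌋) xor_) (⌊transpose≟noMatch⌋ j k≢a k≢b))
          (xor-comm (p ∧ (⌊ j ≟ a ⌋ ∨ ⌊ j ≟ b ⌋)) ⌊ j ≟ k ⌋))

  reflShort-conj-reflLong : ∀ {a b : Fin n} p → a ≢ b →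
                            reflShort a · (reflLong p a b · reflShort a) ≋ reflLong (not p) a b
  reflShort-conj-reflLong {a} {b} p a≢b = ≈W⇒≋ ((λ _ → refl) , λ j →
    trans (cong ((⌊ j ≟ a ⌋ xor p ∧ (⌊ j ≟ a ⌋ ∨ ⌊ j ≟ b ⌋)) xor_) (⌊transpose≟ˡ⌋ a b j))
          (sign-flip p ⌊ j ≟ a ⌋ ⌊ j ≟ b ⌋ (⌊≟⌋-disjoint j a≢b)))

module _ {n : ℕ} where

  open Group (W-group n) using (setoid; ∙-cong; identityˡ; identityʳ) renaming (sym to ≋-sym)
  open Conjugation (W-group n)
    using (Conjugate; commute-cong; sandwich-cong; involution-commute; Conjugate-by-involutions)
  open import Relation.Binary.Reasoning.Setoid setoid

  ≋-refl : ∀ (w : W n) → w ≋ w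
  ≋-refl w = ≈W⇒≋ ((λ _ → refl) , (λ _ → refl))

  data CommutesOrThrough (k : Fin n) (x : W n) : Set where
    commutes : reflShort k · x ≋ x · reflShort k → CommutesOrThrough k x
    through  : ∀ p b → b ≢ k → x ≋ reflLong p k b → CommutesOrThrough k x

  reflLong-commutesOrThrough : ∀ k {x p} {a b : Fin n} → a ≢ b → x ≋ reflLong p a b → CommutesOrThrough k x
  reflLong-commutesOrThrough k {x} {p} {a} {b} a≢b x≋L with k ≟ a | k ≟ b
  ... | yes refl | _ = through p b (a≢b ∘ sym) x≋L
  ... | no _ | yes refl = through p a a≢b (begin
    x                 ≈⟨ x≋L ⟩
    reflLong p a k    ≈⟨ reflLong-comm p a k ⟩
    reflLong p k a    ∎)
  ... | no k≢a | no k≢b = commutes (commute-cong (≋-refl (reflShort k)) x≋L (reflShort-reflLong-comm p k≢a k≢b))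

  commutesOrThrough : ∀ k {x} → IsReflection x → CommutesOrThrough k x
  commutesOrThrough k (inj₁ (c , x≈sᶜ)) =
    commutes (commute-cong (≋-refl (reflShort k)) (≈W⇒≋ x≈sᶜ) (reflShort-comm k c))
  commutesOrThrough k (inj₂ (a , b , a<b , inj₁ x≈L)) = reflLong-commutesOrThrough k (<⇒≢ a<b) (≈W⇒≋ x≈L)
  commutesOrThrough k (inj₂ (a , b , a<b , inj₂ x≈L)) = reflLong-commutesOrThrough k (<⇒≢ a<b) (≈W⇒≋ x≈L)

  private
    square≋ε : ∀ {x y} z → x ≋ z → y ≋ z → z · z ≋ idW → x · y ≋ idW
    square≋ε {x} {y} z x≋z y≋z z²≋ε = begin
      x · y    ≈⟨ ∙-cong x≋z y≋z ⟩
      z · z    ≈⟨ z²≋ε ⟩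
      idW      ∎

  record Conjugator (s r x : W n) : Set where
    constructor conjugator
    field
      g        : W n
      g²≋ε     : g · g ≋ idW
      gr≋rg    : g · r ≋ r · g
      gxg≋sxs  : g · (x · g) ≋ s · (x · s)

  through-conjugator : ∀ {k} {b c : Fin n} {s r x} p q → s ≋ reflShort k → b ≢ k → c ≢ k →
    r ≋ reflLong p k b → x ≋ reflLong q k c →
    ¬ r · x ≋ idW → ¬ (s · (r · s)) · x ≋ idW → Conjugator s r x
  through-conjugator {k} {b} {c} {s} {r} {x} p q s≋sₖ b≢k c≢k r≋L x≋L rx≉ε srsx≉ε with c ≟ b
  ... | no c≢b = conjugator (reflShort c) (reflShort-involutive c)
        (commute-cong (≋-refl (reflShort c)) r≋L (reflShort-reflLong-comm p c≢k c≢b)) (begin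
      reflShort c · (x · reflShort c)               ≈⟨ sandwich-cong (≋-refl (reflShort c)) x≋L ⟩
      reflShort c · (reflLong q k c · reflShort c)  ≈⟨ sandwich-cong (≋-refl (reflShort c)) (reflLong-comm q k c) ⟩
      reflShort c · (reflLong q c k · reflShort c)  ≈⟨ reflShort-conj-reflLong q c≢k ⟩
      reflLong (not q) c k                          ≈⟨ reflLong-comm (not q) c k ⟩
      reflLong (not q) k c                          ≈⟨ reflShort-conj-reflLong q (c≢k ∘ sym) ⟨
      reflShort k · (reflLong q k c · reflShort k)  ≈⟨ sandwich-cong s≋sₖ x≋L ⟨
      s · (x · s)                                   ∎)
  ... | yes refl with q Data.Bool.≟ p
  ...   | yes refl = contradiction (square≋ε (reflLong p k b) r≋L x≋L (reflLong-involutive p k b)) rx≉ε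
  ...   | no q≢p = contradiction (square≋ε (reflLong q k b) srs≋L x≋L (reflLong-involutive q k b)) srsx≉ε
    where
    srs≋L : s · (r · s) ≋ reflLong q k b
    srs≋L = begin
      s · (r · s)                                  ≈⟨ sandwich-cong s≋sₖ r≋L ⟩
      reflShort k · (reflLong p k b · reflShort k) ≈⟨ reflShort-conj-reflLong p (b≢k ∘ sym) ⟩
      reflLong (not p) k b                         ≡⟨ cong (λ p′ → reflLong p′ k b) (sym (¬-not q≢p)) ⟩
      reflLong q k b                               ∎

  short-conjugator : ∀ k {s r x} → s ≋ reflShort k → IsReflection r → IsReflection x →
    ¬ r · x ≋ idW → ¬ (s · (r · s)) · x ≋ idW → Conjugator s r x
  short-conjugator k {s} {r} {x} s≋sₖ r-refl x-refl rx≉ε srsx≉ε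
    with commutesOrThrough k r-refl | commutesOrThrough k x-refl
  ... | commutes sₖr≋rsₖ | _ =
    conjugator (reflShort k) (reflShort-involutive k) sₖr≋rsₖ (sandwich-cong (≋-sym s≋sₖ) (≋-refl x))
  ... | through _ _ _ _ | commutes sₖx≋xsₖ = conjugator idW (identityˡ idW) (begin
      idW · r    ≈⟨ identityˡ r ⟩
      r          ≈⟨ identityʳ r ⟨
      r · idW    ∎) (begin
      idW · (x · idW)                 ≈⟨ identityˡ (x · idW) ⟩
      x · idW                         ≈⟨ identityʳ x ⟩
      x                               ≈⟨ involution-commute (reflShort k) x (reflShort-involutive k) sₖx≋xsₖ ⟨
      reflShort k · (x · reflShort k) ≈⟨ sandwich-cong s≋sₖ (≋-refl x) ⟨
      s · (x · s)                     ∎)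
  ... | through p b b≢k r≋L | through q c c≢k x≋L = through-conjugator p q s≋sₖ b≢k c≢k r≋L x≋L rx≉ε srsx≉ε

  short-reflection-Conjugate : ∀ s r x → IsShortReflection s → IsReflection r → IsReflection x →
    ¬ r · x ≋ idW → ¬ (s · (r · s)) · x ≋ idW → Conjugate (r · x) ((s · (r · s)) · x)
  short-reflection-Conjugate s r x (k , s≈sₖ) r-refl x-refl rx≉ε srsx≉ε =
    Conjugate-by-involutions s g r x s²≋ε g²≋ε gr≋rg gxg≋sxs
    where
    s≋sₖ : s ≋ reflShort k
    s≋sₖ = ≈W⇒≋ s≈sₖ
    s²≋ε : s · s ≋ idW
    s²≋ε = begin
      s · s                      ≈⟨ ∙-cong s≋sₖ s≋sₖ ⟩
      reflShort k · reflShort k  ≈⟨ reflShort-involutive k ⟩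
      idW                        ∎
    open Conjugator (short-conjugator k {s} {r} {x} s≋sₖ r-refl x-refl rx≉ε srsx≉ε)

-- The Hurwitz move

module _ {n : ℕ} where

  lookup-hurwitz-inject₁ : ∀ {m} (ts : Vec (W n) (suc m)) (i : Fin m) →
    lookup (hurwitz (toℕ i) ts) (inject₁ i) ≡
    lookup ts (inject₁ i) · (lookup ts (Fin.suc i) · lookup ts (inject₁ i))
  lookup-hurwitz-inject₁ (a ∷ b ∷ _) Fin.zero    = refl
  lookup-hurwitz-inject₁ (a ∷ ts)    (Fin.suc i) = lookup-hurwitz-inject₁ ts i

  lookup-hurwitz-suc : ∀ {m} (ts : Vec (W n) (suc m)) (i : Fin m) →
    lookup (hurwitz (toℕ i) ts) (Fin.suc i) ≡ lookup ts (inject₁ i)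
  lookup-hurwitz-suc (a ∷ b ∷ _) Fin.zero    = refl
  lookup-hurwitz-suc (a ∷ ts)    (Fin.suc i) = lookup-hurwitz-suc ts i

  lookup-hurwitz-other : ∀ {m} (ts : Vec (W n) (suc m)) (i : Fin m) {a} → a ≢ inject₁ i → a ≢ Fin.suc i →
    lookup (hurwitz (toℕ i) ts) a ≡ lookup ts a
  lookup-hurwitz-other (_ ∷ _ ∷ _) Fin.zero    {Fin.zero}                a≢i _   = contradiction refl a≢i
  lookup-hurwitz-other (_ ∷ _ ∷ _) Fin.zero    {Fin.suc Fin.zero}        _   a≢j = contradiction refl a≢j
  lookup-hurwitz-other (_ ∷ _ ∷ _) Fin.zero    {Fin.suc (Fin.suc _)}     _   _   = refl
  lookup-hurwitz-other (_ ∷ _)     (Fin.suc i) {Fin.zero}                _   _   = refl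
  lookup-hurwitz-other (_ ∷ ts)    (Fin.suc i) {Fin.suc a}               a≢i a≢j =
    lookup-hurwitz-other ts i (a≢i ∘ cong Fin.suc) (a≢j ∘ cong Fin.suc)

module HurwitzMove {n m : ℕ} (ts : Vec (W n) (suc m)) (i : Fin m) where

  open Group (W-group n) using (reflexive)
  open Conjugation (W-group n) using (Conjugate; ≈⇒Conjugate; Conjugate-≈ε; ∙-comm-Conjugate; Conjugate-swap)

  I J : Fin (suc m)
  I = inject₁ i
  J = Fin.suc i

  π : Permutation (suc m) (suc m)
  π = Perm.transpose I J

  t t′ u : Fin (suc m) → W n
  t  = lookup ts
  t′ = lookup (hurwitz (toℕ i) ts)
  u  = t′ ∘ (π ⟨$⟩ʳ_)

  s r : W n
  s = t I
  r = t J

  u-J : u J ≡ s · (r · s)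
  u-J = trans (cong t′ (transpose-matchʳ I J)) (lookup-hurwitz-inject₁ ts i)

  u-other : ∀ {a} → a ≢ J → u a ≡ t a
  u-other {a} a≢J with I ≟ a
  ... | yes refl = trans (cong t′ (transpose-matchˡ I J)) (lookup-hurwitz-suc ts i)
  ... | no I≢a   =
    trans (cong t′ (transpose-noMatch (I≢a ∘ sym) a≢J)) (lookup-hurwitz-other ts i (I≢a ∘ sym) a≢J)

  π-preserves-≢ : ∀ {a b} → a ≢ b → π ⟨$⟩ʳ a ≢ π ⟨$⟩ʳ b
  π-preserves-≢ {a} {b} a≢b πa≡πb =
    a≢b (trans (sym (transpose-involutive I J a)) (trans (cong (π ⟨$⟩ʳ_) πa≡πb) (transpose-involutive I J b)))

  module _ (reflections : All IsReflection ts) (s-short : IsShortReflection s) where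

    J-pair-Conjugate : ∀ b → b ≢ J → ¬ r · t b ≋ idW → ¬ u J · u b ≋ idW → Conjugate (r · t b) (u J · u b)
    J-pair-Conjugate b b≢J rt≉ε uu≉ε = subst (Conjugate (r · t b)) (sym uu≡srst·t)
      (short-reflection-Conjugate s r (t b) s-short (lookup⁺ reflections J) (lookup⁺ reflections b) rt≉ε
        (uu≉ε ∘ subst (_≋ idW) (sym uu≡srst·t)))
      where
      uu≡srst·t : u J · u b ≡ (s · (r · s)) · t b
      uu≡srst·t = cong₂ _·_ u-J (u-other b≢J)

    pair-Conjugate : ∀ a b → a ≢ b → ¬ t a · t b ≋ idW → ¬ u a · u b ≋ idW → Conjugate (t a · t b) (u a · u b)
    pair-Conjugate a b a≢b tt≉ε uu≉ε with J ≟ a | J ≟ b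
    ... | yes refl | yes refl = contradiction refl a≢b
    ... | yes refl | no J≢b   = J-pair-Conjugate b (J≢b ∘ sym) tt≉ε uu≉ε
    ... | no J≢a   | yes refl = Conjugate-swap (t J) (t a) (u J) (u a)
          (J-pair-Conjugate a (J≢a ∘ sym) (tt≉ε ∘ Conjugate-≈ε (∙-comm-Conjugate (t J) (t a)))
                                          (uu≉ε ∘ Conjugate-≈ε (∙-comm-Conjugate (u J) (u a))))
    ... | no J≢a   | no J≢b   =
      ≈⇒Conjugate (reflexive (sym (cong₂ _·_ (u-other (J≢a ∘ sym)) (u-other (J≢b ∘ sym)))))

hurwitz-≅ : ∀ {n m} (ts : Vec (W n) (suc m)) → All IsReflection ts →
  (i : Fin m) → IsShortReflection (lookup ts (inject₁ i)) →
  (Γ Γ′ : Fin (suc m) → Fin (suc m) → ℕ) →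
  IsCarterDiagram ts Γ → IsCarterDiagram (hurwitz (toℕ i) ts) Γ′ → WΓ Γ ≅ᴳ WΓ Γ′
hurwitz-≅ {n} ts reflections i s-short Γ Γ′ Γ-diagram Γ′-diagram = relabel-≅ π weights-preserved
  where
  open HurwitzMove ts i
  open Conjugation (W-group n) using (Conjugate⇒order-≡)

  weights-preserved : ∀ a b → a ≢ b → Γ′ (π ⟨$⟩ʳ a) (π ⟨$⟩ʳ b) ≡ Γ a b
  weights-preserved a b a≢b = +-cancelʳ-≡ 2 _ _ (sym (Conjugate⇒order-≡
    (pair-Conjugate reflections s-short a b a≢b (IsOrder-+2⇒≉ε tt-order) (IsOrder-+2⇒≉ε uu-order))
    (IsOrder⇒HasOrder tt-order) (IsOrder⇒HasOrder uu-order)))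
    where
    tt-order = Γ-diagram a b a≢b
    uu-order = Γ′-diagram (π ⟨$⟩ʳ a) (π ⟨$⟩ʳ b) (π-preserves-≢ a≢b)

proposition4p8 :
    (n : ℕ) (ts : Vec (W n) n) →
    All IsReflection ts → Reduced ts → IsQuasiCoxeter (prod ts) →
    (i : Fin n) → suc (toℕ i) < n → IsShortReflection (lookup ts i) →
    (Γ Γ' : Fin n → Fin n → ℕ) →
    IsCarterDiagram ts Γ → IsCarterDiagram (hurwitz (toℕ i) ts) Γ' →
    WΓ Γ ≅ᴳ WΓ Γ'
proposition4p8 (suc m) ts reflections _ _ i i+1<n short Γ Γ′ Γ-diagram Γ′-diagram =
  hurwitz-≅ ts reflections i′ (subst (IsShortReflection ∘ lookup ts) (sym inject₁i′≡i) short) Γ Γ′ Γ-diagram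
    (subst (λ k → IsCarterDiagram (hurwitz k ts) Γ′) (sym toℕi′≡toℕi) Γ′-diagram)
  where
  i′ : Fin m
  i′ = fromℕ< (s<s⁻¹ i+1<n)
  toℕi′≡toℕi : toℕ i′ ≡ toℕ i
  toℕi′≡toℕi = toℕ-fromℕ< (s<s⁻¹ i+1<n)
  inject₁i′≡i : inject₁ i′ ≡ i
  inject₁i′≡i = toℕ-injective (trans (toℕ-inject₁ i′) toℕi′≡toℕi)
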